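{- Let $P=v_1v_2\dots v_n$ be a path with $\|P\|=n-1$ edges. (1) If $\|P\|\geq 5$ and $\|P\|$ is odd, then $P$ has a proper orientation with $d^-(v_1)=0$, $d^-(v_2)=1$, $d^-(v_{n-2})=0$, $d^-(v_{n-1})=2$ and $d^-(v_n)=0$. (2) If $\|P\|\geq 4$ and $\|P\|$ is even, then $P$ has a proper orientation with $d^-(v_1)=0$, $d^-(v_2)=1$, $d^-(v_{n-1})=1$ and $d^-(v_n)=0$.
   Context: An orientation of a graph is obtained by replacing each edge by one of the two possible arcs on its end-vertices; $d^-(v)$ denotes the in-degree of $v$ in the orientation. An orientation is proper if adjacent vertices have different in-degrees. For a path $P$, $\|P\|$ denotes its number of edges. -}

module Defs where

open import Data.Nat using (ℕ; zero; suc; _+_; _<_; _∸_)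
open import Data.Nat.Properties using (_<?_)
open import Data.Fin using (Fin; toℕ; fromℕ<; inject₁) renaming (suc to fsuc)
open import Data.Bool using (Bool; true; false)
open import Data.Maybe using (Maybe; just; nothing)
open import Data.Product using (Σ; _×_; _,_)
open import Relation.Nullary using (yes; no; ¬_)
open import Relation.Binary.PropositionalEquality using (_≡_)

-- The path with m edges has vertices 0,1,…,m (Fin (suc m));
-- vertex i is v_{i+1} in the paper. Edge e (0 ≤ e < m) joins vertices e, e+1.
-- An orientation assigns to each edge e : Fin m a Bool:
--   true  : arc e → e+1 (head e+1)
--   false : arc e+1 → e (head e)
Orientation : ℕ → Set
Orientation m = Fin m → Bool

edgeAt : {m : ℕ} → Orientation m → ℕ → Maybe Bool
edgeAt {m} o e with e <? m
... | yes e<m = just (o (fromℕ< e<m))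
... | no  _   = nothing

inLeft : Maybe Bool → ℕ
inLeft (just false) = 1
inLeft _            = 0

inRight : Maybe Bool → ℕ
inRight (just true) = 1
inRight _           = 0

indegℕ : {m : ℕ} → Orientation m → ℕ → ℕ
indegℕ o zero    = inLeft (edgeAt o zero)
indegℕ o (suc v) = inRight (edgeAt o v) + inLeft (edgeAt o (suc v))

indeg : {m : ℕ} → Orientation m → Fin (suc m) → ℕ
indeg o v = indegℕ o (toℕ v)

Proper : {m : ℕ} → Orientation m → Set
Proper {m} o = (e : Fin m) → ¬ (indeg o (inject₁ e) ≡ indeg o (fsuc e))

{-# OPTIONS --safe #-}
-- Orient the first edge forwards, the last edge backwards and the edges in
-- between alternately, so that the in-degrees read 0, 1, 2, 0, 2, 0, …, then
-- 2 or 1 depending on the parity of the length, and finally 0.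
--
-- Record the direction of every edge as a
-- boolean and add a virtual backward edge before the path and a virtual
-- forward edge after it. Then the in-degree of every vertex is a function of
-- its two incident directions, and two adjacent vertices have equal in-degree
-- exactly when the three directions around them coincide, i.e. on a directed
-- subpath with three arcs.
module Submission where

open import Defs
open import Data.Bool using (Bool; true; false; not; if_then_else_)
open import Data.Bool.Properties using (not-¬)
open import Data.Fin using (toℕ; inject₁)
open import Data.Fin.Properties using (toℕ-fromℕ<; toℕ-inject₁; toℕ<n)
open import Data.Maybe using (just; nothing)
open import Data.Nat using (ℕ; zero; suc; _+_; _∸_; _≤_; _<_; _%_; _≡ᵇ_; s≤s; z≤n)
open import Data.Nat.Properties
  using (_<?_; <-cmp; <-irrefl; <⇒≤; ≤-refl; ≤-trans; n≤1+n; n<1+n; m≤n⇒m<n∨m≡n)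
open import Data.Product using (Σ; _×_; _,_)
open import Data.Sum using (inj₁; inj₂)
open import Relation.Binary.Definitions using (tri<; tri≈; tri>)
open import Relation.Nullary using (yes; no; ¬_; contradiction)
open import Relation.Binary.PropositionalEquality
  using (_≡_; _≢_; refl; sym; trans; cong; cong₂; module ≡-Reasoning)
open ≡-Reasoning

edgeAt-≥ : {m e : ℕ} (o : Orientation m) → ¬ e < m → edgeAt o e ≡ nothing
edgeAt-≥ {m} {e} o e≮m with e <? m
... | yes e<m = contradiction e<m e≮m
... | no _    = refl

-- d (suc e) is the direction of edge e; d 0 and d (suc m) are virtual edges.
fromDirections : {m : ℕ} → (ℕ → Bool) → Orientation m
fromDirections d e = d (suc (toℕ e))

edgeAt-fromDirections : {m e : ℕ} (d : ℕ → Bool) → e < m →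
                        edgeAt (fromDirections {m} d) e ≡ just (d (suc e))
edgeAt-fromDirections {m} {e} d e<m with e <? m
... | yes e<m′ = cong (λ i → just (d (suc i))) (toℕ-fromℕ< e<m′)
... | no e≮m   = contradiction e<m e≮m

arrivals : Bool → Bool → ℕ
arrivals b c = inRight (just b) + inLeft (just c)

arrivals-equal : {a b c : Bool} → arrivals a b ≡ arrivals b c → a ≡ b × b ≡ c
arrivals-equal {false} {false} {false} _ = refl , refl
arrivals-equal {true}  {true}  {true}  _ = refl , refl
arrivals-equal {false} {false} {true}  ()
arrivals-equal {false} {true}  {false} ()
arrivals-equal {false} {true}  {true}  ()
arrivals-equal {true}  {false} {false} ()
arrivals-equal {true}  {false} {true}  ()
arrivals-equal {true}  {true}  {false} ()

arrivals-alternating : (b : Bool) → arrivals b (not b) ≡ (if b then 2 else 0)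
arrivals-alternating true  = refl
arrivals-alternating false = refl

arrivals-backward : (b : Bool) → arrivals b false ≡ (if b then 2 else 1)
arrivals-backward true  = refl
arrivals-backward false = refl

module _ {m : ℕ} (d : ℕ → Bool) (start : d 0 ≡ false) (end : d (suc m) ≡ true) where

  private
    o : Orientation m
    o = fromDirections d

  inLeft-edgeAt-fromDirections : {e : ℕ} → e ≤ m → inLeft (edgeAt o e) ≡ inLeft (just (d (suc e)))
  inLeft-edgeAt-fromDirections e≤m with m≤n⇒m<n∨m≡n e≤m
  ... | inj₁ e<m = cong inLeft (edgeAt-fromDirections d e<m)
  ... | inj₂ refl rewrite edgeAt-≥ o (<-irrefl refl) | end = refl

  indegℕ-fromDirections : {v : ℕ} → v ≤ m → indegℕ o v ≡ arrivals (d v) (d (suc v))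
  indegℕ-fromDirections {zero} _ rewrite start = inLeft-edgeAt-fromDirections z≤n
  indegℕ-fromDirections {suc v} v<m =
    cong₂ _+_ (cong inRight (edgeAt-fromDirections d v<m)) (inLeft-edgeAt-fromDirections v<m)

  fromDirections-proper :
    ((v : ℕ) → v < m → ¬ (d v ≡ d (suc v) × d (suc v) ≡ d (suc (suc v)))) → Proper o
  fromDirections-proper noDirected3 e same = noDirected3 v v<m (arrivals-equal (begin
      arrivals (d v) (d (suc v))              ≡⟨ sym (indegℕ-fromDirections (<⇒≤ v<m)) ⟩
      indegℕ o v                              ≡⟨ cong (indegℕ o) (sym (toℕ-inject₁ e)) ⟩
      indegℕ o (toℕ (inject₁ e))              ≡⟨ same ⟩
      indegℕ o (suc v)                        ≡⟨ indegℕ-fromDirections v<m ⟩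
      arrivals (d (suc v)) (d (suc (suc v)))  ∎))
    where
    v = toℕ e
    v<m = toℕ<n e

even : ℕ → Bool
even zero          = true
even (suc zero)    = false
even (suc (suc n)) = even n

even-suc : (n : ℕ) → even (suc n) ≡ not (even n)
even-suc zero          = refl
even-suc (suc zero)    = refl
even-suc (suc (suc n)) = even-suc n

even≡[n%2≡ᵇ0] : (n : ℕ) → even n ≡ (n % 2 ≡ᵇ 0)
even≡[n%2≡ᵇ0] zero          = refl
even≡[n%2≡ᵇ0] (suc zero)    = refl
even≡[n%2≡ᵇ0] (suc (suc n)) = even≡[n%2≡ᵇ0] n

-- Indexed as for fromDirections: zigzag m (suc e) is the direction of edge e.
zigzag : ℕ → ℕ → Bool
zigzag m zero          = false
zigzag m (suc zero)    = true
zigzag m (suc (suc k)) with <-cmp (suc (suc k)) m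
... | tri< _ _ _ = even k
... | tri≈ _ _ _ = false
... | tri> _ _ _ = true

zigzag-below : {m k : ℕ} → 2 ≤ k → k < m → zigzag m k ≡ even k
zigzag-below {m} {suc (suc k)} (s≤s (s≤s _)) k<m with <-cmp (suc (suc k)) m
... | tri< _ _ _    = refl
... | tri≈ k≮m _ _  = contradiction k<m k≮m
... | tri> k≮m _ _  = contradiction k<m k≮m

zigzag-last : {m : ℕ} → 2 ≤ m → zigzag m m ≡ false
zigzag-last {suc (suc m)} (s≤s (s≤s _)) with <-cmp (suc (suc m)) (suc (suc m))
... | tri< m<m _ _ = contradiction m<m (<-irrefl refl)
... | tri≈ _ _ _   = refl
... | tri> _ _ m>m = contradiction m>m (<-irrefl refl)

zigzag-past : (m : ℕ) → zigzag m (suc m) ≡ true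
zigzag-past zero = refl
zigzag-past (suc m) with <-cmp (suc (suc m)) (suc m)
... | tri< _ _ m+2≯m+1 = contradiction (n<1+n (suc m)) m+2≯m+1
... | tri≈ _ _ m+2≯m+1 = contradiction (n<1+n (suc m)) m+2≯m+1
... | tri> _ _ _       = refl

zigzag-alternates : {m k : ℕ} → 2 ≤ k → suc k < m → zigzag m k ≢ zigzag m (suc k)
zigzag-alternates {m} {k} 2≤k k+1<m same = not-¬ refl (begin
  even k                ≡⟨ sym (zigzag-below 2≤k (<⇒≤ k+1<m)) ⟩
  zigzag m k            ≡⟨ same ⟩
  zigzag m (suc k)      ≡⟨ zigzag-below (≤-trans 2≤k (n≤1+n k)) k+1<m ⟩
  even (suc k)          ≡⟨ even-suc k ⟩
  not (even k)          ∎)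

zigzag-noDirected3 : {m : ℕ} → 4 ≤ m → (v : ℕ) → v < m →
                     ¬ (zigzag m v ≡ zigzag m (suc v) × zigzag m (suc v) ≡ zigzag m (suc (suc v)))
zigzag-noDirected3 _   zero       _ (() , _)
zigzag-noDirected3 4≤m (suc zero) _ (_ , same) = zigzag-alternates ≤-refl 4≤m same
zigzag-noDirected3 _ (suc (suc w)) v<m (same , same′) with m≤n⇒m<n∨m≡n v<m
... | inj₁ v+1<m = zigzag-alternates (s≤s (s≤s z≤n)) v+1<m same
... | inj₂ refl = contradiction (trans (sym last) (trans same′ (zigzag-past (suc v)))) λ ()
  where
  v = suc (suc w)
  last : zigzag (suc v) (suc v) ≡ false
  last = zigzag-last {suc v} (s≤s (s≤s z≤n))

zigzagOrientation : (m : ℕ) → Orientation m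
zigzagOrientation m = fromDirections (zigzag m)

indegℕ-zigzag : (m v : ℕ) → v ≤ m →
                indegℕ (zigzagOrientation m) v ≡ arrivals (zigzag m v) (zigzag m (suc v))
indegℕ-zigzag m v = indegℕ-fromDirections (zigzag m) refl (zigzag-past m)

zigzag-proper : {m : ℕ} → 4 ≤ m → Proper (zigzagOrientation m)
zigzag-proper {m} 4≤m = fromDirections-proper (zigzag m) refl (zigzag-past m) (zigzag-noDirected3 4≤m)

indegℕ-zigzag-first : (m : ℕ) → indegℕ (zigzagOrientation m) 0 ≡ 0
indegℕ-zigzag-first m = indegℕ-zigzag m 0 z≤n

indegℕ-zigzag-second : (m : ℕ) → 3 ≤ m → indegℕ (zigzagOrientation m) 1 ≡ 1
indegℕ-zigzag-second m 3≤m =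
  trans (indegℕ-zigzag m 1 (≤-trans (s≤s z≤n) 3≤m)) (cong (arrivals true) (zigzag-below ≤-refl 3≤m))

indegℕ-zigzag-interior : {m : ℕ} (v : ℕ) → 2 ≤ v → suc v < m →
                         indegℕ (zigzagOrientation m) v ≡ (if even v then 2 else 0)
indegℕ-zigzag-interior {m} v 2≤v v+1<m = begin
  indegℕ (zigzagOrientation m) v             ≡⟨ indegℕ-zigzag m v (≤-trans (n≤1+n v) (<⇒≤ v+1<m)) ⟩
  arrivals (zigzag m v) (zigzag m (suc v))   ≡⟨ cong₂ arrivals (zigzag-below 2≤v (<⇒≤ v+1<m))
                                                               (zigzag-below (≤-trans 2≤v (n≤1+n v)) v+1<m) ⟩
  arrivals (even v) (even (suc v))           ≡⟨ cong (arrivals (even v)) (even-suc v) ⟩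
  arrivals (even v) (not (even v))           ≡⟨ arrivals-alternating (even v) ⟩
  (if even v then 2 else 0)                  ∎

indegℕ-zigzag-penultimate : (v : ℕ) → 2 ≤ v → indegℕ (zigzagOrientation (suc v)) v ≡ (if even v then 2 else 1)
indegℕ-zigzag-penultimate v 2≤v = begin
  indegℕ (zigzagOrientation (suc v)) v                 ≡⟨ indegℕ-zigzag (suc v) v (n≤1+n v) ⟩
  arrivals (zigzag (suc v) v) (zigzag (suc v) (suc v)) ≡⟨ cong₂ arrivals (zigzag-below 2≤v ≤-refl)
                                                                       (zigzag-last (≤-trans 2≤v (n≤1+n v))) ⟩
  arrivals (even v) false                              ≡⟨ arrivals-backward (even v) ⟩
  (if even v then 2 else 1)                            ∎

indegℕ-zigzag-last : (m : ℕ) → 2 ≤ m → indegℕ (zigzagOrientation m) m ≡ 0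
indegℕ-zigzag-last m 2≤m =
  trans (indegℕ-zigzag m m ≤-refl) (cong₂ arrivals (zigzag-last 2≤m) (zigzag-past m))

odd-path-orientation : (m : ℕ) → 5 ≤ m → m % 2 ≡ 1 →
                       Σ (Orientation m) λ o → Proper o
                         × indegℕ o 0 ≡ 0 × indegℕ o 1 ≡ 1
                         × indegℕ o (m ∸ 2) ≡ 0 × indegℕ o (m ∸ 1) ≡ 2
                         × indegℕ o m ≡ 0
odd-path-orientation m@(suc (suc (suc (suc k)))) (s≤s (s≤s (s≤s (s≤s _)))) m-odd =
    zigzagOrientation m , zigzag-proper (s≤s (s≤s (s≤s (s≤s z≤n))))
  , indegℕ-zigzag-first m , indegℕ-zigzag-second m (s≤s (s≤s (s≤s z≤n)))
  , trans (indegℕ-zigzag-interior (suc (suc k)) (s≤s (s≤s z≤n)) ≤-refl) (cong (λ b → if b then 2 else 0) k-odd)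
  , trans (indegℕ-zigzag-penultimate (suc (suc (suc k))) (s≤s (s≤s z≤n))) (cong (λ b → if b then 2 else 1) k+1-even)
  , indegℕ-zigzag-last m (s≤s (s≤s z≤n))
  where
  k-odd : even k ≡ false
  k-odd = trans (even≡[n%2≡ᵇ0] k) (cong (_≡ᵇ 0) m-odd)
  k+1-even : even (suc k) ≡ true
  k+1-even = trans (even-suc k) (cong not k-odd)

even-path-orientation : (m : ℕ) → 4 ≤ m → m % 2 ≡ 0 →
                        Σ (Orientation m) λ o → Proper o
                          × indegℕ o 0 ≡ 0 × indegℕ o 1 ≡ 1
                          × indegℕ o (m ∸ 1) ≡ 1 × indegℕ o m ≡ 0
even-path-orientation m@(suc (suc (suc (suc k)))) (s≤s (s≤s (s≤s (s≤s _)))) m-even =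
    zigzagOrientation m , zigzag-proper (s≤s (s≤s (s≤s (s≤s z≤n))))
  , indegℕ-zigzag-first m , indegℕ-zigzag-second m (s≤s (s≤s (s≤s z≤n)))
  , trans (indegℕ-zigzag-penultimate (suc (suc (suc k))) (s≤s (s≤s z≤n))) (cong (λ b → if b then 2 else 1) k+1-odd)
  , indegℕ-zigzag-last m (s≤s (s≤s z≤n))
  where
  k-even : even k ≡ true
  k-even = trans (even≡[n%2≡ᵇ0] k) (cong (_≡ᵇ 0) m-even)
  k+1-odd : even (suc k) ≡ false
  k+1-odd = trans (even-suc k) (cong not k-even)

lemma5 : ((m : ℕ) → 5 ≤ m → m % 2 ≡ 1 →
              Σ (Orientation m) λ o → Proper o
                × indegℕ o 0 ≡ 0 × indegℕ o 1 ≡ 1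
                × indegℕ o (m ∸ 2) ≡ 0 × indegℕ o (m ∸ 1) ≡ 2
                × indegℕ o m ≡ 0)
         × ((m : ℕ) → 4 ≤ m → m % 2 ≡ 0 →
              Σ (Orientation m) λ o → Proper o
                × indegℕ o 0 ≡ 0 × indegℕ o 1 ≡ 1
                × indegℕ o (m ∸ 1) ≡ 1 × indegℕ o m ≡ 0)
lemma5 = odd-path-orientation , even-path-orientation
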